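{- For positive integers $a,b$ let $N(a,b)=\frac{1}{a}\binom{a}{b}\binom{a}{b-1}$. Then: (1) if $n>1$ is an odd integer, then $N\left(n^2,\frac{n^2+1}{2}\right)$ is a perfect square; (2) if $n>2$ is an even integer, then $N\left(n^2-2,\frac{n^2-2}{2}\right)$ is a perfect square; (3) for every positive integer $n$, $N(n^2(n^2+1),n^2+1)$ is a perfect square. In particular there are infinitely many pairs $(a,b)$ of integers with $a>b>1$ such that $N(a,b)$ is a perfect square.
   Context: $N(a,b)$ is the Narayana number. A perfect square means the square of an integer. -}

module Defs where

open import Data.Nat using (ℕ; zero; suc; _+_; _*_; _∸_; _^_; _/_; _<_; NonZero)
open import Data.Nat.Combinatorics using (_C_)
open import Data.Product using (∃-syntax)
open import Relation.Binary.PropositionalEquality using (_≡_)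

-- The product  C(a,b) * C(a,b-1)  whose quotient by a is the Narayana number.
-- (Used only for b ≥ 1, where b ∸ 1 = b - 1.)
narayanaNumerator : ℕ → ℕ → ℕ
narayanaNumerator a b = (a C b) * (a C (b ∸ 1))

-- "N(a,b) = (1/a) C(a,b) C(a,b-1) is a perfect square", stated without
-- truncating division: there is an integer m with N(a,b) = m^2,
-- i.e. C(a,b) C(a,b-1) = a * m^2 (a ≥ 1).
NarayanaIsSquare : ℕ → ℕ → Set
NarayanaIsSquare a b = ∃[ m ] narayanaNumerator a b ≡ a * (m * m)

-- Absorption, k·C(n,k) = n·C(n−1,k−1), and its consequence
-- (k+1)·C(n,k+1) + k·C(n,k) = n·C(n,k) give (k+1)·C(2k,k+1) = k·C(2k,k); hence
-- C(2k,k) = (k+1)·c and C(2k,k+1) = k·c with c the k-th Catalan number. So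
-- C(2k+1,k+1) = C(2k+1,k) = (2k+1)·c, which is (1) with n² = 2k+1, and
-- C(2k,k)·C(2k,k−1) = k(k+1)·c², which is (2) with n² = 2k+2, since then k(k+1) = 2k·(n/2)².
-- For a = s(s+1) absorption gives C(a,s) = (s+1)·x and C(a,s+1) = s²·x with x = C(a−1,s−1),
-- so C(a,s+1)·C(a,s) = a·s·x², which is (3) with s = n²; letting n grow gives the last claim.
module Submission where

open import Data.Nat
open import Data.Nat.Combinatorics using (_C_; nCk≡nC[n∸k]; k>n⇒nCk≡0; nC1≡n; nCk+nC[k+1]≡[n+1]C[k+1])
open import Data.Nat.DivMod using (m≡m%n+[m/n]*n; m*n/n≡m; m≥n⇒m/n>0)
open import Data.Nat.Properties
open import Data.Nat.Tactic.RingSolver using (solve-∀)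
open import Data.Product using (_×_; _,_; ∃-syntax)
open import Relation.Binary.PropositionalEquality
open ≡-Reasoning

open import Defs

[1+k]*[1+n]C[1+k]≡[1+n]*nCk : ∀ n k → suc k * (suc n C suc k) ≡ suc n * (n C k)
[1+k]*[1+n]C[1+k]≡[1+n]*nCk zero    zero    = refl
[1+k]*[1+n]C[1+k]≡[1+n]*nCk zero    (suc k)
  rewrite k>n⇒nCk≡0 {1} {suc (suc k)} (s≤s (s≤s z≤n)) = *-zeroʳ k
[1+k]*[1+n]C[1+k]≡[1+n]*nCk (suc n) zero
  rewrite nC1≡n (suc (suc n)) = *-comm 1 (suc (suc n))
[1+k]*[1+n]C[1+k]≡[1+n]*nCk (suc n) (suc k) = begin
  suc (suc k) * (suc (suc n) C suc (suc k))
    ≡⟨ cong (suc (suc k) *_) (nCk+nC[k+1]≡[n+1]C[k+1] (suc n) (suc k)) ⟨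
  suc (suc k) * (a + b)               ≡⟨ *-distribˡ-+ (suc (suc k)) a b ⟩
  a + suc k * a + suc (suc k) * b
    ≡⟨ cong₂ (λ u v → a + u + v) ([1+k]*[1+n]C[1+k]≡[1+n]*nCk n k) ([1+k]*[1+n]C[1+k]≡[1+n]*nCk n (suc k)) ⟩
  a + suc n * c + suc n * d           ≡⟨ +-assoc a (suc n * c) (suc n * d) ⟩
  a + (suc n * c + suc n * d)         ≡⟨ cong (a +_) (*-distribˡ-+ (suc n) c d) ⟨
  a + suc n * (c + d)                 ≡⟨ cong (λ u → a + suc n * u) (nCk+nC[k+1]≡[n+1]C[k+1] n k) ⟩
  suc (suc n) * a                     ∎
  where
  a = suc n C suc k
  b = suc n C suc (suc k)
  c = n C k
  d = n C suc k

[1+k]*nC[1+k]+k*nCk≡n*nCk : ∀ n k → suc k * (n C suc k) + k * (n C k) ≡ n * (n C k)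
[1+k]*nC[1+k]+k*nCk≡n*nCk n k = +-cancelʳ-≡ c _ _ (begin
  suc k * e + k * c + c       ≡⟨ +-assoc (suc k * e) (k * c) c ⟩
  suc k * e + (k * c + c)     ≡⟨ cong (suc k * e +_) (+-comm (k * c) c) ⟩
  suc k * e + suc k * c       ≡⟨ *-distribˡ-+ (suc k) e c ⟨
  suc k * (e + c)             ≡⟨ cong (suc k *_) (+-comm e c) ⟩
  suc k * (c + e)             ≡⟨ cong (suc k *_) (nCk+nC[k+1]≡[n+1]C[k+1] n k) ⟩
  suc k * (suc n C suc k)     ≡⟨ [1+k]*[1+n]C[1+k]≡[1+n]*nCk n k ⟩
  suc n * c                   ≡⟨ +-comm c (n * c) ⟩
  n * c + c                   ∎)
  where
  c = n C k
  e = n C suc k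

nCk≡nCj : ∀ {n k j} → k + j ≡ n → n C k ≡ n C j
nCk≡nCj {k = k} {j} refl = trans (nCk≡nC[n∸k] (m≤m+n k j)) (cong ((k + j) C_) (m+n∸m≡n k j))

-- The Catalan number C(2k,k)/(k+1), written as a difference to avoid division.
catalan : ℕ → ℕ
catalan k = (k + k) C k ∸ (k + k) C suc k

[1+k]*[2k]C[1+k]≡k*[2k]Ck : ∀ k → suc k * ((k + k) C suc k) ≡ k * ((k + k) C k)
[1+k]*[2k]C[1+k]≡k*[2k]Ck k = +-cancelʳ-≡ (k * d) _ _ (begin
  suc k * ((k + k) C suc k) + k * d   ≡⟨ [1+k]*nC[1+k]+k*nCk≡n*nCk (k + k) k ⟩
  (k + k) * d                         ≡⟨ *-distribʳ-+ d k k ⟩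
  k * d + k * d                       ∎)
  where d = (k + k) C k

[2k]Ck≡[2k]C[1+k]+catalan : ∀ k → (k + k) C k ≡ (k + k) C suc k + catalan k
[2k]Ck≡[2k]C[1+k]+catalan k = sym (m+[n∸m]≡n (*-cancelˡ-≤ (suc k)
  (≤-trans (≤-reflexive ([1+k]*[2k]C[1+k]≡k*[2k]Ck k)) (*-monoˡ-≤ ((k + k) C k) (n≤1+n k)))))

[2k]C[1+k]≡k*catalan : ∀ k → (k + k) C suc k ≡ k * catalan k
[2k]C[1+k]≡k*catalan k = +-cancelˡ-≡ (k * e) _ _ (begin
  k * e + e                ≡⟨ +-comm (k * e) e ⟩
  suc k * e                ≡⟨ [1+k]*[2k]C[1+k]≡k*[2k]Ck k ⟩
  k * ((k + k) C k)        ≡⟨ cong (k *_) ([2k]Ck≡[2k]C[1+k]+catalan k) ⟩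
  k * (e + catalan k)      ≡⟨ *-distribˡ-+ k e (catalan k) ⟩
  k * e + k * catalan k    ∎)
  where e = (k + k) C suc k

[2k]Ck≡[1+k]*catalan : ∀ k → (k + k) C k ≡ suc k * catalan k
[2k]Ck≡[1+k]*catalan k = begin
  (k + k) C k                        ≡⟨ [2k]Ck≡[2k]C[1+k]+catalan k ⟩
  (k + k) C suc k + catalan k        ≡⟨ cong (_+ catalan k) ([2k]C[1+k]≡k*catalan k) ⟩
  k * catalan k + catalan k          ≡⟨ +-comm (k * catalan k) (catalan k) ⟩
  suc k * catalan k                  ∎

narayanaNumerator-odd : ∀ k →
  narayanaNumerator (suc (k + k)) (suc k) ≡ suc (k + k) * catalan k * (suc (k + k) * catalan k)
narayanaNumerator-odd k = begin
  f * ((suc k + k) C k)  ≡⟨ cong (f *_) (nCk≡nCj {k = suc k} {k} refl) ⟨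
  f * f                  ≡⟨ cong (λ u → u * u) f≡[2k+1]*catalan ⟩
  suc (k + k) * catalan k * (suc (k + k) * catalan k) ∎
  where
  f = suc (k + k) C suc k
  f≡[2k+1]*catalan : f ≡ suc (k + k) * catalan k
  f≡[2k+1]*catalan = begin
    f                                    ≡⟨ nCk+nC[k+1]≡[n+1]C[k+1] (k + k) k ⟨
    (k + k) C k + (k + k) C suc k        ≡⟨ cong₂ _+_ ([2k]Ck≡[1+k]*catalan k) ([2k]C[1+k]≡k*catalan k) ⟩
    suc k * catalan k + k * catalan k    ≡⟨ *-distribʳ-+ (catalan k) (suc k) k ⟨
    suc (k + k) * catalan k              ∎

narayanaNumerator-even : ∀ k →
  narayanaNumerator (suc k + suc k) (suc k) ≡ suc (suc k) * catalan (suc k) * (suc k * catalan (suc k))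
narayanaNumerator-even k = begin
  ((c + c) C c) * ((c + c) C k)      ≡⟨ cong (((c + c) C c) *_) (nCk≡nCj {k = k} {suc c} (+-suc k c)) ⟩
  ((c + c) C c) * ((c + c) C suc c)  ≡⟨ cong₂ _*_ ([2k]Ck≡[1+k]*catalan c) ([2k]C[1+k]≡k*catalan c) ⟩
  suc c * catalan c * (c * catalan c) ∎
  where c = suc k

narayanaNumerator-pronic : ∀ r → let s = suc r in
  ∃[ x ] narayanaNumerator (s * suc s) (suc s) ≡ s * (s * x) * (suc s * x)
narayanaNumerator-pronic r = x , cong₂ _*_ (trans aC[1+s]≡s*mCs (cong (s *_) mCs≡s*x)) aCs≡[1+s]*x
  where
  s = suc r
  a = s * suc s
  m = pred a
  x = m C r
  aCs≡[1+s]*x : a C s ≡ suc s * x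
  aCs≡[1+s]*x = *-cancelˡ-≡ _ _ s (begin
    s * (a C s)           ≡⟨ [1+k]*[1+n]C[1+k]≡[1+n]*nCk m r ⟩
    s * suc s * x         ≡⟨ *-assoc s (suc s) x ⟩
    s * (suc s * x)       ∎)
  aC[1+s]≡s*mCs : a C suc s ≡ s * (m C s)
  aC[1+s]≡s*mCs = *-cancelˡ-≡ _ _ (suc s) (begin
    suc s * (a C suc s)       ≡⟨ [1+k]*[1+n]C[1+k]≡[1+n]*nCk m s ⟩
    s * suc s * (m C s)       ≡⟨ cong (_* (m C s)) (*-comm s (suc s)) ⟩
    suc s * s * (m C s)       ≡⟨ *-assoc (suc s) s (m C s) ⟩
    suc s * (s * (m C s))     ∎)
  -- The left factor is pred (s * suc s) as it reduces, i.e. m = s² + r.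
  m≡s*s+r : ∀ r y → (suc r + r * suc (suc r)) * y ≡ suc r * (suc r * y) + r * y
  m≡s*s+r = solve-∀
  mCs≡s*x : m C s ≡ s * x
  mCs≡s*x = *-cancelˡ-≡ _ _ s (+-cancelʳ-≡ (r * x) _ _
    (trans ([1+k]*nC[1+k]+k*nCk≡n*nCk m r) (m≡s*s+r r x)))

[m+m]/2≡m : ∀ m → (m + m) / 2 ≡ m
[m+m]/2≡m m = trans (cong (_/ 2) (m+m≡m*2 m)) (m*n/n≡m m 2)
  where
  m+m≡m*2 : ∀ m → m + m ≡ m * 2
  m+m≡m*2 = solve-∀

narayanaIsSquare-odd : ∀ n j → n ≡ suc (j * 2) → NarayanaIsSquare (n * n) ((n * n + 1) / 2)
narayanaIsSquare-odd n j refl = n * catalan k , (begin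
  narayanaNumerator (n * n) ((n * n + 1) / 2)      ≡⟨ cong₂ narayanaNumerator n²≡1+2k b≡1+k ⟩
  narayanaNumerator (suc (k + k)) (suc k)          ≡⟨ narayanaNumerator-odd k ⟩
  suc (k + k) * catalan k * (suc (k + k) * catalan k)
    ≡⟨ cong (λ a → a * catalan k * (a * catalan k)) n²≡1+2k ⟨
  n * n * catalan k * (n * n * catalan k)          ≡⟨ square-of-product n (catalan k) ⟩
  n * n * (n * catalan k * (n * catalan k))        ∎)
  where
  k = j * suc j * 2
  odd-square : ∀ j → suc (j * 2) * suc (j * 2) ≡ suc (j * suc j * 2 + j * suc j * 2)
  odd-square = solve-∀
  n²≡1+2k : n * n ≡ suc (k + k)
  n²≡1+2k = odd-square j
  b≡1+k : (n * n + 1) / 2 ≡ suc k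
  b≡1+k = begin
    (n * n + 1) / 2            ≡⟨ cong (λ a → (a + 1) / 2) n²≡1+2k ⟩
    (suc (k + k) + 1) / 2      ≡⟨ cong (_/ 2) (+-comm (suc (k + k)) 1) ⟩
    suc (suc (k + k)) / 2      ≡⟨ cong (λ a → suc a / 2) (+-suc k k) ⟨
    (suc k + suc k) / 2        ≡⟨ [m+m]/2≡m (suc k) ⟩
    suc k                      ∎
  square-of-product : ∀ n x → n * n * x * (n * n * x) ≡ n * n * (n * x * (n * x))
  square-of-product = solve-∀

narayanaIsSquare-even : ∀ n j → 0 < j → n ≡ j * 2 → NarayanaIsSquare (n * n ∸ 2) ((n * n ∸ 2) / 2)
narayanaIsSquare-even n (suc i) _ refl = suc i * catalan c , (begin
  narayanaNumerator (n * n ∸ 2) ((n * n ∸ 2) / 2)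
    ≡⟨ cong₂ narayanaNumerator a≡2c (trans (cong (_/ 2) a≡2c) ([m+m]/2≡m c)) ⟩
  narayanaNumerator (c + c) c                         ≡⟨ narayanaNumerator-even t ⟩
  suc c * catalan c * (c * catalan c)                 ≡⟨ even-rearrange i (catalan c) ⟩
  (c + c) * (suc i * catalan c * (suc i * catalan c)) ≡⟨ cong (_* (suc i * catalan c * (suc i * catalan c))) a≡2c ⟨
  (n * n ∸ 2) * (suc i * catalan c * (suc i * catalan c)) ∎)
  where
  -- n = 2(i+1), so n² − 2 = 2c and c + 1 = 2(i+1)².
  t = i * i * 2 + i * 4
  c = suc t
  even-square : ∀ i → suc i * 2 * (suc i * 2) ≡ 2 + (suc (i * i * 2 + i * 4) + suc (i * i * 2 + i * 4))
  even-square = solve-∀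
  a≡2c : n * n ∸ 2 ≡ c + c
  a≡2c = cong (_∸ 2) (even-square i)
  even-rearrange : ∀ i x → suc (suc (i * i * 2 + i * 4)) * x * (suc (i * i * 2 + i * 4) * x)
                         ≡ (suc (i * i * 2 + i * 4) + suc (i * i * 2 + i * 4)) * (suc i * x * (suc i * x))
  even-rearrange = solve-∀

narayanaIsSquare-pronic : ∀ n → 0 < n → NarayanaIsSquare (n * n * (n * n + 1)) (n * n + 1)
narayanaIsSquare-pronic n@(suc m) _ with narayanaNumerator-pronic (m + m * suc m)
... | x , eq = n * x , (begin
  narayanaNumerator (n * n * (n * n + 1)) (n * n + 1)
    ≡⟨ cong (λ b → narayanaNumerator (n * n * b) b) (+-comm (n * n) 1) ⟩
  narayanaNumerator (n * n * suc (n * n)) (suc (n * n)) ≡⟨ eq ⟩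
  n * n * (n * n * x) * (suc (n * n) * x)               ≡⟨ pronic-rearrange n x ⟩
  n * n * (n * n + 1) * (n * x * (n * x))               ∎)
  where
  pronic-rearrange : ∀ n x → n * n * (n * n * x) * (suc (n * n) * x) ≡ n * n * (n * n + 1) * (n * x * (n * x))
  pronic-rearrange = solve-∀

odd⇒≡1+[n/2]*2 : ∀ n → n % 2 ≡ 1 → n ≡ suc (n / 2 * 2)
odd⇒≡1+[n/2]*2 n n%2≡1 = trans (m≡m%n+[m/n]*n n 2) (cong (_+ n / 2 * 2) n%2≡1)

even⇒≡[n/2]*2 : ∀ n → n % 2 ≡ 0 → n ≡ n / 2 * 2
even⇒≡[n/2]*2 n n%2≡0 = trans (m≡m%n+[m/n]*n n 2) (cong (_+ n / 2 * 2) n%2≡0)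

infinitelyManySquares : ∀ B → ∃[ a ] ∃[ b ] (B < a × b < a × 1 < b × NarayanaIsSquare a b)
infinitelyManySquares B = s * b , b , B<s*b , b<s*b , s≤s (s≤s z≤n) , narayanaIsSquare-pronic n (s≤s z≤n)
  where
  n = suc (suc B)
  s = n * n
  b = s + 1
  B<s*b : B < s * b
  B<s*b = m<n⇒m<n*o b (<-≤-trans (m<n⇒m<1+n (n<1+n B)) (m≤m*n n n))
  b<s*b : b < s * b
  b<s*b = subst (b <_) (*-comm b s) (m<m*n b s (s≤s (s≤s z≤n)))

mainTheorem2 : (∀ (n : ℕ) → 1 < n → n % 2 ≡ 1 → NarayanaIsSquare (n * n) ((n * n + 1) / 2))
    × (∀ (n : ℕ) → 2 < n → n % 2 ≡ 0 → NarayanaIsSquare (n * n ∸ 2) ((n * n ∸ 2) / 2))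
    × (∀ (n : ℕ) → 0 < n → NarayanaIsSquare (n * n * (n * n + 1)) (n * n + 1))
    × (∀ (B : ℕ) → ∃[ a ] ∃[ b ] (B < a × b < a × 1 < b × NarayanaIsSquare a b))
-- Part (1) holds for n = 1 as well.
mainTheorem2 =
    (λ n _ odd → narayanaIsSquare-odd n (n / 2) (odd⇒≡1+[n/2]*2 n odd))
  , (λ n 2<n even → narayanaIsSquare-even n (n / 2) (m≥n⇒m/n>0 (<⇒≤ 2<n)) (even⇒≡[n/2]*2 n even))
  , narayanaIsSquare-pronic
  , infinitelyManySquares
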